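{- Let \(G=(V,E)\) be a simple, undirected, connected graph that is not a cactus but such that \(G-e\) is a cactus for every \(e\in E\). Let \(C_1\) and \(C_2\) be two cycles in \(G\) that share at least one edge. Then for every cycle \(C\) of \(G\), \(E(C)\cap E(C_1)\neq\emptyset\).
   Context: A cactus is a connected graph in which every edge belongs to at most one (simple) cycle. \(G-e=(V,E\setminus\{e\})\). -}

module Defs where

open import Data.Nat using (ℕ; zero; suc; _≤_)
open import Data.Fin using (Fin; zero; suc; inject₁; fromℕ; _≟_)
open import Data.Bool using (Bool; true; false; _∧_; not)
open import Data.Product using (Σ; ∃; _×_; _,_)
open import Data.Sum using (_⊎_)
open import Data.Empty using (⊥)
open import Relation.Nullary using (¬_)
open import Relation.Nullary.Decidable using (⌊_⌋)
open import Relation.Binary.PropositionalEquality using (_≡_)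
open import Function.Definitions using (Injective)

-- A (finite, simple, undirected) graph on vertex set Fin n is given by a
-- Bool-valued adjacency relation; symmetry and irreflexivity are assumed
-- separately where needed.
AdjRel : ℕ → Set
AdjRel n = Fin n → Fin n → Bool

Symmetric : ∀ {n} → AdjRel n → Set
Symmetric {n} A = ∀ (u v : Fin n) → A u v ≡ A v u

Irreflexive : ∀ {n} → AdjRel n → Set
Irreflexive {n} A = ∀ (u : Fin n) → A u u ≡ false

SamePair : ∀ {n} → Fin n → Fin n → Fin n → Fin n → Set
SamePair u v a b = (u ≡ a × v ≡ b) ⊎ (u ≡ b × v ≡ a)

samePair? : ∀ {n} → Fin n → Fin n → Fin n → Fin n → Bool
samePair? u v a b = (⌊ u ≟ a ⌋ ∧ ⌊ v ≟ b ⌋) Data.Bool.∨ (⌊ u ≟ b ⌋ ∧ ⌊ v ≟ a ⌋)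
  where import Data.Bool

deleteEdge : ∀ {n} → AdjRel n → Fin n → Fin n → AdjRel n
deleteEdge A a b u v = A u v ∧ not (samePair? u v a b)

data Walk {n} (A : AdjRel n) : Fin n → Fin n → Set where
  here : ∀ {u} → Walk A u u
  step : ∀ {u v w} → A u v ≡ true → Walk A v w → Walk A u w

Connected : ∀ {n} → AdjRel n → Set
Connected {n} A = ∀ (u v : Fin n) → Walk A u v

-- A (simple) cycle: distinct vertices v₀,…,v_k (k ≥ 2, so length ≥ 3)
-- with v_i ~ v_{i+1} and v_k ~ v₀.
record Cycle {n} (A : AdjRel n) : Set where
  field
    k     : ℕ
    k≥2   : 2 ≤ k
    vert  : Fin (suc k) → Fin n
    inj   : Injective _≡_ _≡_ vert
    path  : ∀ (i : Fin k) → A (vert (inject₁ i)) (vert (suc i)) ≡ true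
    close : A (vert (fromℕ k)) (vert zero) ≡ true

open Cycle public

EdgeOf : ∀ {n} {A : AdjRel n} → Cycle A → Fin n → Fin n → Set
EdgeOf C u v =
  (Σ (Fin (k C)) λ i → SamePair u v (vert C (inject₁ i)) (vert C (suc i)))
  ⊎ SamePair u v (vert C (fromℕ (k C))) (vert C zero)

-- two cycles are the same cycle (as subgraphs) iff they have the same edges
SameCycle : ∀ {n} {A : AdjRel n} → Cycle A → Cycle A → Set
SameCycle {n} C D = ∀ (u v : Fin n) → (EdgeOf C u v → EdgeOf D u v) × (EdgeOf D u v → EdgeOf C u v)

ShareEdge : ∀ {n} {A : AdjRel n} → Cycle A → Cycle A → Set
ShareEdge {n} C D = Σ (Fin n) λ u → Σ (Fin n) λ v → EdgeOf C u v × EdgeOf D u v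

Cactus : ∀ {n} → AdjRel n → Set
Cactus {n} A = Connected A ×
  (∀ (u v : Fin n) → A u v ≡ true → (C D : Cycle A) → EdgeOf C u v → EdgeOf D u v → SameCycle C D)

{-# OPTIONS --safe #-}
module Submission where

-- A cycle X whose edges all lie on another cycle Y, which has an edge h not on X, is impossible:
-- numbering the vertices of the path Y − h in order turns X into an injective closed sequence of
-- naturals of length at least 3 with steps ±1, and such a sequence never turns back, so it cannot
-- close up.  Hence distinct cycles are never nested.
--
-- For the theorem, let f be an edge of C not on C₁.  Then f lies on C₂, for otherwise C₁ and C₂
-- would be distinct cycles of the cactus G − f sharing an edge.  As C₁ is not nested in C₂, some
-- edge h of C₁ is not on C₂.  If h is not on C either, C and C₂ are cycles of the cactus G − h
-- sharing f, so they coincide and C contains the edge shared by C₁ and C₂.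

open import Defs
open import Data.Nat using (ℕ; zero; suc; _+_; _∸_; _≤_; _<_; z≤n; s≤s; _<?_)
open import Data.Nat.Properties
  using (+-suc; +-∸-assoc; ∸-cancelʳ-≡; +-cancelʳ-≡; ∸-monoˡ-≤; m≤n+m; n<1+n; <-≤-trans; ≤∧≢⇒<;
         <⇒≢; m≢1+n+m; m<n⇒m<1+n; ≤-pred; module ≤-Reasoning)
import Data.Nat.Properties as ℕ
open import Data.Fin using (Fin; zero; suc; inject₁; fromℕ; toℕ; _≟_)
open import Data.Fin.Properties
  using (toℕ-injective; toℕ-inject₁; toℕ-fromℕ; toℕ≤pred[n]; inject₁-injective; fromℕ≢inject₁;
         any?; all?; ¬∀⟶∃¬)
import Data.Fin.Properties as Fin
open import Data.Bool using (true; _∧_; _∨_; not)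
open import Data.Product using (∃; ∃₂; _×_; _,_; proj₂)
open import Data.Sum using (_⊎_; inj₁; inj₂; swap)
open import Data.Empty using (⊥; ⊥-elim)
open import Function using (_∘_; flip)
open import Function.Definitions using (Injective)
open import Relation.Nullary using (¬_; Dec; yes; no; contradiction)
open import Relation.Nullary.Decidable using (_×-dec_; _⊎-dec_; does; dec-false; isYes≗does)
open import Relation.Binary.PropositionalEquality
  using (_≡_; _≢_; refl; sym; trans; cong; cong₂; module ≡-Reasoning)

infix 4 _↗_

_↗_ : ℕ → ℕ → Set
x ↗ y = y ≡ suc x

OneApart : ℕ → ℕ → Set
OneApart x y = x ↗ y ⊎ y ↗ x

Along : {X : Set} → (X → X → Set) → ∀ {l} → (Fin (suc l) → X) → Set
Along R {l} s = ∀ (i : Fin l) → R (s (inject₁ i)) (s (suc i))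

↗-injectiveˡ : ∀ {x y z} → x ↗ z → y ↗ z → x ≡ y
↗-injectiveˡ z≡1+x z≡1+y = ℕ.suc-injective (trans (sym z≡1+x) z≡1+y)

↘-injectiveˡ : ∀ {x y z} → z ↗ x → z ↗ y → x ≡ y
↘-injectiveˡ x≡1+z y≡1+z = trans x≡1+z (sym y≡1+z)

-- An injective sequence cannot step back onto the value it just left.
along-persists : ∀ (R : ℕ → ℕ → Set) → (∀ {x y z} → R x z → R y z → x ≡ y) →
                 ∀ {l} (s : Fin (suc (suc l)) → ℕ) → Injective _≡_ _≡_ s →
                 Along (λ x y → R x y ⊎ R y x) s → R (s zero) (s (suc zero)) → Along R s
along-persists R R-injˡ s s-inj steps first zero = first
along-persists R R-injˡ {suc l} s s-inj steps first (suc i) =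
  along-persists R R-injˡ (s ∘ suc) (Fin.suc-injective ∘ s-inj) (λ i → steps (suc i)) second i
  where
  second : R (s (suc zero)) (s (suc (suc zero)))
  second with steps (suc zero)
  ... | inj₁ forward  = forward
  ... | inj₂ backward = contradiction (s-inj (R-injˡ first backward)) λ ()

along-↗ : ∀ {l} (s : Fin (suc l) → ℕ) → Along _↗_ s → s (fromℕ l) ≡ l + s zero
along-↗ {zero}  s _  = refl
along-↗ {suc l} s up = begin
  s (suc (fromℕ l))  ≡⟨ along-↗ (s ∘ suc) (λ i → up (suc i)) ⟩
  l + s (suc zero)   ≡⟨ cong (l +_) (up zero) ⟩
  l + suc (s zero)   ≡⟨ +-suc l (s zero) ⟩
  suc l + s zero     ∎
  where open ≡-Reasoning

along-↘ : ∀ {l} (s : Fin (suc l) → ℕ) → Along (flip _↗_) s → s zero ≡ l + s (fromℕ l)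
along-↘ {zero}  s _    = refl
along-↘ {suc l} s down = begin
  s zero                     ≡⟨ down zero ⟩
  suc (s (suc zero))         ≡⟨ cong suc (along-↘ (s ∘ suc) (λ i → down (suc i))) ⟩
  suc l + s (suc (fromℕ l))  ∎
  where open ≡-Reasoning

far⇒¬OneApart : ∀ l {x y} → x ≡ suc (suc l) + y → ¬ OneApart x y
far⇒¬OneApart l {x} {y} x≡ (inj₁ y≡1+x) = m≢1+n+m y (trans y≡1+x (cong suc x≡))
far⇒¬OneApart l {x} {y} x≡ (inj₂ x≡1+y) = m≢1+n+m y (ℕ.suc-injective (trans (sym x≡1+y) x≡))

closed-OneApart-walk-not-injective : ∀ {l} → 2 ≤ l → (s : Fin (suc l) → ℕ) →
  Along OneApart s → OneApart (s (fromℕ l)) (s zero) → ¬ Injective _≡_ _≡_ s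
closed-OneApart-walk-not-injective {suc (suc l)} (s≤s (s≤s z≤n)) s steps closing s-inj
  with steps zero
... | inj₁ up = far⇒¬OneApart l (along-↗ s all-up) closing
  where all-up = along-persists _↗_ ↗-injectiveˡ s s-inj steps up
... | inj₂ down = far⇒¬OneApart l (along-↘ s all-down) (swap closing)
  where all-down = along-persists (flip _↗_) ↘-injectiveˡ s s-inj (λ i → swap (steps i)) down

-- Position i of a cycle with positions 0 … m, renumbered so that J + 1 becomes 0 and J becomes m.
rotate : ℕ → ℕ → ℕ → ℕ
rotate m J i with J <? i
... | yes _ = i ∸ suc J
... | no  _ = i + (m ∸ J)

rotate-suc : ∀ m J i → i ≢ J → rotate m J (suc i) ≡ suc (rotate m J i)
rotate-suc m J i i≢J with J <? i | J <? suc i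
... | yes J<i | yes _      = +-∸-assoc 1 J<i
... | yes J<i | no  J≮1+i  = contradiction (m<n⇒m<1+n J<i) J≮1+i
... | no  J≮i | yes J<1+i  = contradiction (≤∧≢⇒< (≤-pred J<1+i) (i≢J ∘ sym)) J≮i
... | no  _   | no  _      = refl

rotate-wrap : ∀ {m J} → J < m → rotate m J 0 ≡ suc (rotate m J m)
rotate-wrap {m} {J} J<m with J <? m | J <? 0
... | yes _   | no _  = +-∸-assoc 1 J<m
... | no  J≮m | _     = contradiction J<m J≮m
... | _       | yes ()

∸-suc<+∸ : ∀ {m J i} j → J < i → i ≤ m → i ∸ suc J < j + (m ∸ J)
∸-suc<+∸ {m} {J} {i} j J<i i≤m = begin-strict
  i ∸ suc J        ≤⟨ ∸-monoˡ-≤ (suc J) i≤m ⟩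
  m ∸ suc J        <⟨ n<1+n _ ⟩
  suc (m ∸ suc J)  ≡⟨ +-∸-assoc 1 (<-≤-trans J<i i≤m) ⟨
  m ∸ J            ≤⟨ m≤n+m _ j ⟩
  j + (m ∸ J)      ∎
  where open ≤-Reasoning

rotate-injective : ∀ {m J i j} → i ≤ m → j ≤ m → rotate m J i ≡ rotate m J j → i ≡ j
rotate-injective {m} {J} {i} {j} i≤m j≤m eq with J <? i | J <? j
... | yes J<i | yes J<j = ∸-cancelʳ-≡ J<i J<j eq
... | no  _   | no  _   = +-cancelʳ-≡ (m ∸ J) i j eq
... | yes J<i | no  _   = contradiction eq (<⇒≢ (∸-suc<+∸ j J<i i≤m))
... | no  _   | yes J<j = contradiction (sym eq) (<⇒≢ (∸-suc<+∸ i J<j j≤m))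

SamePair-sym : ∀ {n} {u v a b : Fin n} → SamePair u v a b → SamePair a b u v
SamePair-sym (inj₁ (refl , refl)) = inj₁ (refl , refl)
SamePair-sym (inj₂ (refl , refl)) = inj₂ (refl , refl)

SamePair-swap : ∀ {n} {u v a b : Fin n} → SamePair u v a b → SamePair v u a b
SamePair-swap (inj₁ (u≡a , v≡b)) = inj₂ (v≡b , u≡a)
SamePair-swap (inj₂ (u≡b , v≡a)) = inj₁ (v≡a , u≡b)

SamePair-trans : ∀ {n} {u v a b c d : Fin n} →
                 SamePair u v a b → SamePair a b c d → SamePair u v c d
SamePair-trans (inj₁ (refl , refl)) ab~cd = ab~cd
SamePair-trans (inj₂ (refl , refl)) ab~cd = SamePair-swap ab~cd

SamePair? : ∀ {n} (u v a b : Fin n) → Dec (SamePair u v a b)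
SamePair? u v a b = ((u ≟ a) ×-dec (v ≟ b)) ⊎-dec ((u ≟ b) ×-dec (v ≟ a))

OneApart-resp : ∀ {n} (f : Fin n → ℕ) {u v a b} → SamePair u v a b →
                OneApart (f a) (f b) → OneApart (f u) (f v)
OneApart-resp f (inj₁ (refl , refl)) = λ ab → ab
OneApart-resp f (inj₂ (refl , refl)) = swap

samePair?≡does : ∀ {n} (u v a b : Fin n) → samePair? u v a b ≡ does (SamePair? u v a b)
samePair?≡does u v a b = cong₂ _∨_ (cong₂ _∧_ (isYes≗does (u ≟ a)) (isYes≗does (v ≟ b)))
                                    (cong₂ _∧_ (isYes≗does (u ≟ b)) (isYes≗does (v ≟ a)))

module _ {n : ℕ} {A : AdjRel n} where

  infix 4 _⊆ᴱ_

  _⊆ᴱ_ : Cycle A → Cycle A → Set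
  X ⊆ᴱ Y = ∀ {u v} → EdgeOf X u v → EdgeOf Y u v

  OnCycle : Cycle A → Fin n → Set
  OnCycle C v = ∃ λ i → vert C i ≡ v

  pathEdge : (C : Cycle A) (i : Fin (k C)) → EdgeOf C (vert C (inject₁ i)) (vert C (suc i))
  pathEdge C i = inj₁ (i , inj₁ (refl , refl))

  closingEdge : (C : Cycle A) → EdgeOf C (vert C (fromℕ (k C))) (vert C zero)
  closingEdge C = inj₂ (inj₁ (refl , refl))

  EdgeOf-resp : (C : Cycle A) → ∀ {u v a b} → EdgeOf C u v → SamePair u v a b → EdgeOf C a b
  EdgeOf-resp C (inj₁ (i , uv~i)) uv~ab = inj₁ (i , SamePair-trans (SamePair-sym uv~ab) uv~i)
  EdgeOf-resp C (inj₂ uv~last)    uv~ab = inj₂ (SamePair-trans (SamePair-sym uv~ab) uv~last)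

  edgeOf? : (C : Cycle A) (u v : Fin n) → Dec (EdgeOf C u v)
  edgeOf? C u v = any? (λ i → SamePair? u v (vert C (inject₁ i)) (vert C (suc i)))
                  ⊎-dec SamePair? u v (vert C (fromℕ (k C))) (vert C zero)

  EdgeOf⇒Adj : Symmetric A → (C : Cycle A) → ∀ {u v} → EdgeOf C u v → A u v ≡ true
  EdgeOf⇒Adj sym-A C (inj₁ (i , inj₁ (refl , refl))) = path C i
  EdgeOf⇒Adj sym-A C (inj₁ (i , inj₂ (refl , refl))) = trans (sym-A _ _) (path C i)
  EdgeOf⇒Adj sym-A C (inj₂ (inj₁ (refl , refl)))     = close C
  EdgeOf⇒Adj sym-A C (inj₂ (inj₂ (refl , refl)))     = trans (sym-A _ _) (close C)

  EdgeOf⇒OnCycle : (C : Cycle A) → ∀ {u v} → EdgeOf C u v → OnCycle C v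
  EdgeOf⇒OnCycle C (inj₁ (i , inj₁ (_ , refl))) = suc i , refl
  EdgeOf⇒OnCycle C (inj₁ (i , inj₂ (_ , refl))) = inject₁ i , refl
  EdgeOf⇒OnCycle C (inj₂ (inj₁ (_ , refl)))     = zero , refl
  EdgeOf⇒OnCycle C (inj₂ (inj₂ (_ , refl)))     = fromℕ (k C) , refl

  ⊆ᴱ⇒OnCycle : (X Y : Cycle A) → X ⊆ᴱ Y → ∀ r → OnCycle Y (vert X r)
  ⊆ᴱ⇒OnCycle X Y X⊆Y zero    = EdgeOf⇒OnCycle Y (X⊆Y (closingEdge X))
  ⊆ᴱ⇒OnCycle X Y X⊆Y (suc r) = EdgeOf⇒OnCycle Y (X⊆Y (pathEdge X r))

  ⊆ᴱ-or-outside : (X Y : Cycle A) → X ⊆ᴱ Y ⊎ ∃₂ λ u v → EdgeOf X u v × ¬ EdgeOf Y u v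
  ⊆ᴱ-or-outside X Y with all? (λ i → edgeOf? Y (vert X (inject₁ i)) (vert X (suc i)))
                        | edgeOf? Y (vert X (fromℕ (k X))) (vert X zero)
  ... | yes path⊆Y | yes last∈Y = inj₁ λ where
    (inj₁ (i , uv~i)) → EdgeOf-resp Y (path⊆Y i) (SamePair-sym uv~i)
    (inj₂ uv~last)    → EdgeOf-resp Y last∈Y (SamePair-sym uv~last)
  ... | _ | no last∉Y = inj₂ (_ , _ , closingEdge X , last∉Y)
  ... | no ¬path⊆Y | _ with ¬∀⟶∃¬ _ _ (λ i → edgeOf? Y _ _) ¬path⊆Y
  ...   | i , i∉Y = inj₂ (_ , _ , pathEdge X i , i∉Y)

  deleteEdge-keeps : ∀ {a b u v} → A u v ≡ true → ¬ SamePair u v a b → deleteEdge A a b u v ≡ true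
  deleteEdge-keeps {a} {b} {u} {v} uv∈A uv≁ab = cong₂ (λ x y → x ∧ not y) uv∈A
    (trans (samePair?≡does u v a b) (dec-false (SamePair? u v a b) uv≁ab))

  deleteEdge-cycle : ∀ {a b} (C : Cycle A) → ¬ EdgeOf C a b → Cycle (deleteEdge A a b)
  deleteEdge-cycle C ab∉C = record
    { k     = k C
    ; k≥2   = k≥2 C
    ; vert  = vert C
    ; inj   = inj C
    ; path  = λ i → deleteEdge-keeps (path C i) (ab∉C ∘ EdgeOf-resp C (pathEdge C i))
    ; close = deleteEdge-keeps (close C) (ab∉C ∘ EdgeOf-resp C (closingEdge C))
    }

  deleteEdge-cactus⇒SameCycle : Symmetric A → ∀ {a b} → Cactus (deleteEdge A a b) →
    (C D : Cycle A) → ¬ EdgeOf C a b → ¬ EdgeOf D a b → ShareEdge C D → SameCycle C D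
  deleteEdge-cactus⇒SameCycle sym-A (_ , unique) C D ab∉C ab∉D (u , v , uv∈C , uv∈D) =
    unique u v (deleteEdge-keeps (EdgeOf⇒Adj sym-A C uv∈C) (ab∉C ∘ EdgeOf-resp C uv∈C))
           (deleteEdge-cycle C ab∉C) (deleteEdge-cycle D ab∉D) uv∈C uv∈D

  position : (C : Cycle A) → ∀ {u v} → EdgeOf C u v → Fin (suc (k C))
  position C (inj₁ (i , _)) = inject₁ i
  position C (inj₂ _)       = fromℕ (k C)

  position-injective : (C : Cycle A) → ∀ {u v a b} (uv∈C : EdgeOf C u v) (ab∈C : EdgeOf C a b) →
                       position C uv∈C ≡ position C ab∈C → SamePair u v a b
  position-injective C (inj₁ (i , uv~i)) (inj₁ (j , ab~j)) i≡j with inject₁-injective i≡j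
  ... | refl = SamePair-trans uv~i (SamePair-sym ab~j)
  position-injective C (inj₁ _) (inj₂ _) i≡last = contradiction (sym i≡last) fromℕ≢inject₁
  position-injective C (inj₂ _) (inj₁ _) last≡j = contradiction last≡j fromℕ≢inject₁
  position-injective C (inj₂ uv~last) (inj₂ ab~last) _ =
    SamePair-trans uv~last (SamePair-sym ab~last)

  -- A vertex's potential is its rank on the path left by cutting Y at its edge at position J.
  module CutPotential (Y : Cycle A) (J : Fin (suc (k Y))) where

    -- junk value zero off the vertices of Y
    index : Fin n → Fin (suc (k Y))
    index v with any? (λ i → vert Y i ≟ v)
    ... | yes (i , _) = i
    ... | no  _       = zero

    index-vert : ∀ i → index (vert Y i) ≡ i
    index-vert i with any? (λ j → vert Y j ≟ vert Y i)
    ... | yes (j , Yj≡Yi) = inj Y Yj≡Yi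
    ... | no  ¬∃          = contradiction (i , refl) ¬∃

    renumber : ℕ → ℕ
    renumber = rotate (k Y) (toℕ J)

    potential : Fin n → ℕ
    potential v = renumber (toℕ (index v))

    potential-vert : ∀ i → potential (vert Y i) ≡ renumber (toℕ i)
    potential-vert i = cong (renumber ∘ toℕ) (index-vert i)

    potential-injective : ∀ {u v} → OnCycle Y u → OnCycle Y v → potential u ≡ potential v → u ≡ v
    potential-injective (i , refl) (j , refl) eq = cong (vert Y) (toℕ-injective
      (rotate-injective (toℕ≤pred[n] i) (toℕ≤pred[n] j)
        (trans (sym (potential-vert i)) (trans eq (potential-vert j)))))

    potential-step : ∀ {u v} (uv∈Y : EdgeOf Y u v) → position Y uv∈Y ≢ J →
                     OneApart (potential u) (potential v)
    potential-step (inj₁ (i , uv~i)) i≢J = OneApart-resp potential uv~i (inj₁ (begin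
      potential (vert Y (suc i))            ≡⟨ potential-vert (suc i) ⟩
      renumber (suc (toℕ i))                ≡⟨ rotate-suc (k Y) (toℕ J) (toℕ i) toℕi≢J ⟩
      suc (renumber (toℕ i))                ≡⟨ cong (suc ∘ renumber) (toℕ-inject₁ i) ⟨
      suc (renumber (toℕ (inject₁ i)))      ≡⟨ cong suc (potential-vert (inject₁ i)) ⟨
      suc (potential (vert Y (inject₁ i)))  ∎))
      where
      open ≡-Reasoning
      toℕi≢J : toℕ i ≢ toℕ J
      toℕi≢J eq = i≢J (toℕ-injective (trans (toℕ-inject₁ i) eq))
    potential-step (inj₂ uv~last) last≢J = OneApart-resp potential uv~last (inj₁ (begin
      potential (vert Y zero)                 ≡⟨ potential-vert zero ⟩
      renumber 0                              ≡⟨ rotate-wrap J<k ⟩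
      suc (renumber (k Y))                    ≡⟨ cong (suc ∘ renumber) (toℕ-fromℕ (k Y)) ⟨
      suc (renumber (toℕ (fromℕ (k Y))))      ≡⟨ cong suc (potential-vert (fromℕ (k Y))) ⟨
      suc (potential (vert Y (fromℕ (k Y))))  ∎))
      where
      open ≡-Reasoning
      J<k : toℕ J < k Y
      J<k = ≤∧≢⇒< (toℕ≤pred[n] J) λ J≡k →
        last≢J (toℕ-injective (trans (toℕ-fromℕ (k Y)) (sym J≡k)))

  ⊆ᴱ⇒⊇ᴱ : (X Y : Cycle A) → X ⊆ᴱ Y → Y ⊆ᴱ X
  ⊆ᴱ⇒⊇ᴱ X Y X⊆Y {a} {b} ab∈Y with edgeOf? X a b
  ... | yes ab∈X = ab∈X
  ... | no  ab∉X = ⊥-elim (closed-OneApart-walk-not-injective (k≥2 X) (potential ∘ vert X)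
                     (λ i → steps (pathEdge X i)) (steps (closingEdge X))
                     (λ eq → inj X (potential-injective (onY _) (onY _) eq)))
    where
    open CutPotential Y (position Y ab∈Y)

    onY : ∀ r → OnCycle Y (vert X r)
    onY = ⊆ᴱ⇒OnCycle X Y X⊆Y

    steps : ∀ {u v} → EdgeOf X u v → OneApart (potential u) (potential v)
    steps uv∈X = potential-step (X⊆Y uv∈X) λ same →
      ab∉X (EdgeOf-resp X uv∈X (position-injective Y (X⊆Y uv∈X) ab∈Y same))

lemma7 : (n : ℕ) (A : AdjRel n) → Symmetric A → Irreflexive A →
         Connected A → ¬ Cactus A →
         (∀ a b → A a b ≡ true → Cactus (deleteEdge A a b)) →
         (C₁ C₂ : Cycle A) → ¬ SameCycle C₁ C₂ → ShareEdge C₁ C₂ →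
         (C : Cycle A) → ShareEdge C C₁
lemma7 n A sym-A _ _ _ cactus-minus C₁ C₂ C₁≠C₂ (u₀ , v₀ , e∈C₁ , e∈C₂) C = via (closingEdge C)
  where
  unique-avoiding : (D₀ : Cycle A) → ∀ {a b} → EdgeOf D₀ a b → (D D′ : Cycle A) →
                    ¬ EdgeOf D a b → ¬ EdgeOf D′ a b → ShareEdge D D′ → SameCycle D D′
  unique-avoiding D₀ ab∈D₀ =
    deleteEdge-cactus⇒SameCycle sym-A (cactus-minus _ _ (EdgeOf⇒Adj sym-A D₀ ab∈D₀))

  via : ∀ {u v} → EdgeOf C u v → ShareEdge C C₁
  via {u} {v} f∈C with edgeOf? C₁ u v | edgeOf? C₂ u v
  ... | yes f∈C₁ | _ = u , v , f∈C , f∈C₁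
  ... | no f∉C₁ | no f∉C₂ =
    ⊥-elim (C₁≠C₂ (unique-avoiding C f∈C C₁ C₂ f∉C₁ f∉C₂ (u₀ , v₀ , e∈C₁ , e∈C₂)))
  ... | no f∉C₁ | yes f∈C₂ with ⊆ᴱ-or-outside C₁ C₂
  ...   | inj₁ C₁⊆C₂ = ⊥-elim (C₁≠C₂ λ _ _ → C₁⊆C₂ , ⊆ᴱ⇒⊇ᴱ C₁ C₂ C₁⊆C₂)
  ...   | inj₂ (a , b , h∈C₁ , h∉C₂) with edgeOf? C a b
  ...     | yes h∈C = a , b , h∈C , h∈C₁
  ...     | no  h∉C =
    u₀ , v₀ , proj₂ (unique-avoiding C₁ h∈C₁ C C₂ h∉C h∉C₂ (u , v , f∈C , f∈C₂) u₀ v₀) e∈C₂ , e∈C₁
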